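{- Every Past LTL formula admits an equivalent program of $\mathcal{L}(\mathcal{S})$ of linear size (i.e., of size linear in the size of the formula).
   Context: Past LTL formulas are built from propositional variables, the constants $\top,\bot$, the Boolean operators $\neg,\land,\lor$, the before operator $\ominus$ (with $I,t \models \ominus\alpha$ iff $I,t-1\models\alpha$) and the since operator $\mathsf{S}$ (with $I,t \models \alpha\,\mathsf{S}\,\beta$ iff there is $j\in[1,t]$ with $I,j\models\beta$ and $I,k\models\alpha$ for all $k\in[j+1,t]$), interpreted over finite non-empty sequences $I=I_1\dots I_\ell$ of sets of propositional variables. A (temporal) program is a finite, nonrecursive (acyclic dependency graph), definitorial (each variable defined by at most one rule) set of rules of three kinds: static rules $p \;{:}{ - }\; \alpha$ with $\alpha$ a static (Boolean) formula; delay rules $p \;{:}{ - }\; \ominus q$; and dynamic rules $p_1,\dots,p_n \;{:}{ - }\; \mathcal{A}(a_1,\dots,a_m)$, where $\mathcal{A}=\langle \mathbb{B}^m,[1,n],\delta,q_\mathrm{init}\rangle$ is an operator automaton (a semiautomaton on assignments with an initial state). Semantics: a variable defined by a static rule holds at $t$ iff its body holds at $t$; one defined by a delay rule holds at $t$ iff $q$ holds at $t-1$; for a dynamic rule, $p_i$ holds at time $0$ iff $q_\mathrm{init}=i$, and at $t>0$ iff for some $j$ and some assignment $\sigma$ to $a_1,\dots,a_m$ we have $\delta(j,\sigma)=i$, $p_j$ holds at $t-1$ and $\sigma$ holds at $t$ (so the head variables give a one-hot encoding of the automaton state). $\mathcal{L}(\mathcal{S})$ is the set of programs using static rules, delay rules,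 and dynamic rules whose operator is the since automaton $\mathcal{S}=\langle\mathbb{B}^2,\{1,2\},\delta,1\rangle$ with $\delta(q,10)=q$, $\delta(q,01)=\delta(q,11)=2$, $\delta(q,00)=1$ (inputs given as values of $(a,b)$), so that $a\,\mathsf{S}\,b$ corresponds to $q_2$ in the rule $q_1,q_2 \;{:}{ - }\; \mathcal{S}(a,b)$. Equivalence of a formula $\varphi$ and a program $P$ means that for some variable $p$ of $P$, $(P,I,t)\models p$ iff $I,t\models\varphi$ for all interpretations $I$ and times $t$. -}

module Defs where

open import Data.Nat using (ℕ; zero; suc; _+_; _*_; _∸_; _≤_; _<_)
open import Data.Bool using (Bool; true; false; not; _∧_; _∨_)
open import Data.Fin using (Fin; zero; suc)
open import Data.List using (List; []; _∷_; length; concatMap; map)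
open import Data.Nat.ListAction using (sum)
open import Data.List.Membership.Propositional using (_∈_)
open import Data.List.Relation.Unary.Unique.Propositional using (Unique)
open import Data.Product using (Σ; _×_; _,_; ∃)
open import Data.Sum using (_⊎_)
open import Data.Unit using (⊤)
open import Data.Empty using (⊥)
open import Relation.Nullary using (¬_)
open import Relation.Binary.PropositionalEquality using (_≡_)
open import Function.Bundles using (_⇔_)

Var : Set
Var = ℕ

VarSet : Set
VarSet = Var → Bool

-- An interpretation I = I₁ … I_ℓ is a list of sets of variables;
-- it is required to be non-empty where it is used.
Interp : Set
Interp = List VarSet

-- I_t for t ∈ [1, ℓ]; by convention I_0 = ∅ (and positions beyond ℓ
-- are also ∅; they are never queried).
at : Interp → ℕ → VarSet
at I        zero          = λ _ → false
at []       (suc t)       = λ _ → false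
at (x ∷ xs) (suc zero)    = x
at (x ∷ xs) (suc (suc t)) = at xs (suc t)

data Formula : Set where
  var   : Var → Formula
  ⊤F    : Formula
  ⊥F    : Formula
  ¬F_   : Formula → Formula
  _∧F_  : Formula → Formula → Formula
  _∨F_  : Formula → Formula → Formula
  ⊖_    : Formula → Formula
  _S_   : Formula → Formula → Formula

-- I , t ⊨ φ   (meaningful for t ∈ [1, ℓ])
_,_⊨_ : Interp → ℕ → Formula → Set
I , t ⊨ var p   = at I t p ≡ true
I , t ⊨ ⊤F      = ⊤
I , t ⊨ ⊥F      = ⊥
I , t ⊨ (¬F α)  = ¬ (I , t ⊨ α)
I , t ⊨ (α ∧F β) = (I , t ⊨ α) × (I , t ⊨ β)
I , t ⊨ (α ∨F β) = (I , t ⊨ α) ⊎ (I , t ⊨ β)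
-- position t-1 exists only if t ≥ 2
I , t ⊨ (⊖ α)   = (2 ≤ t) × (I , (t ∸ 1) ⊨ α)
I , t ⊨ (α S β) = ∃ λ j → (1 ≤ j) × (j ≤ t) × (I , j ⊨ β)
                     × (∀ k → j < k → k ≤ t → I , k ⊨ α)

fsize : Formula → ℕ
fsize (var p)  = 1
fsize ⊤F       = 1
fsize ⊥F       = 1
fsize (¬F α)   = 1 + fsize α
fsize (α ∧F β) = 1 + fsize α + fsize β
fsize (α ∨F β) = 1 + fsize α + fsize β
fsize (⊖ α)    = 1 + fsize α
fsize (α S β)  = 1 + fsize α + fsize β

data BFormula : Set where
  bvar : Var → BFormula
  b⊤ b⊥ : BFormula
  b¬   : BFormula → BFormula
  b∧ b∨ : BFormula → BFormula → BFormula

beval : VarSet → BFormula → Bool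
beval v (bvar p)  = v p
beval v b⊤        = true
beval v b⊥        = false
beval v (b¬ α)    = not (beval v α)
beval v (b∧ α β)  = beval v α ∧ beval v β
beval v (b∨ α β)  = beval v α ∨ beval v β

bvars : BFormula → List Var
bvars (bvar p)  = p ∷ []
bvars b⊤        = []
bvars b⊥        = []
bvars (b¬ α)    = bvars α
bvars (b∧ α β)  = bvars α Data.List.++ bvars β
bvars (b∨ α β)  = bvars α Data.List.++ bvars β

bsize : BFormula → ℕ
bsize (bvar p)  = 1
bsize b⊤        = 1
bsize b⊥        = 1
bsize (b¬ α)    = 1 + bsize α
bsize (b∧ α β)  = 1 + bsize α + bsize β
bsize (b∨ α β)  = 1 + bsize α + bsize β

-- The since operator automaton S = ⟨ 𝔹², {1,2}, δ, 1 ⟩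
-- states: zero = 1, suc zero = 2;  inputs: values of (a , b)

δS : Fin 2 → Bool → Bool → Fin 2
δS q true  false = q
δS q false true  = suc zero
δS q true  true  = suc zero
δS q false false = zero

qinitS : Fin 2
qinitS = zero

data Rule : Set where
  static : Var → BFormula → Rule
  -- p :- ⊖ q
  delay  : Var → Var → Rule
  -- q₁ , q₂ :- S(a , b)
  since  : Var → Var → Var → Var → Rule

Program : Set
Program = List Rule

ruleHeads : Rule → List Var
ruleHeads (static p α)      = p ∷ []
ruleHeads (delay p q)       = p ∷ []
ruleHeads (since q₁ q₂ a b) = q₁ ∷ q₂ ∷ []

ruleBody : Rule → List Var
ruleBody (static p α)      = bvars α
ruleBody (delay p q)       = q ∷ []
ruleBody (since q₁ q₂ a b) = a ∷ b ∷ []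

heads : Program → List Var
heads P = concatMap ruleHeads P

vars : Program → List Var
vars P = concatMap (λ r → ruleHeads r Data.List.++ ruleBody r) P

-- definitorial: each variable defined by at most one rule (and the heads
-- of a dynamic rule are pairwise distinct)
Definitorial : Program → Set
Definitorial P = Unique (heads P)

Dep : Program → Var → Var → Set
Dep P u v = ∃ λ r → (r ∈ P) × (u ∈ ruleHeads r) × (v ∈ ruleBody r)

data Path (P : Program) : Var → Var → Set where
  step : ∀ {u v}   → Dep P u v → Path P u v
  _▸_  : ∀ {u v w} → Dep P u v → Path P v w → Path P u w

Nonrecursive : Program → Set
Nonrecursive P = ∀ v → ¬ Path P v v

-- membership in L(S): rules are syntactically of the three allowed kinds;
-- in addition the program must be nonrecursive and definitorial.
InLS : Program → Set
InLS P = Nonrecursive P × Definitorial P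

rsize : Rule → ℕ
rsize (static p α)      = 1 + bsize α
rsize (delay p q)       = 2
rsize (since q₁ q₂ a b) = 4

psize : Program → ℕ
psize P = sum (map rsize P)

-- A trace V assigns to each time t ∈ ℕ (t = 0 included) a set of
-- variables.
-- For a nonrecursive definitorial program the solution is unique, and
-- (P , I , t) ⊨ p  means  V t p ≡ true  for it.

Trace : Set
Trace = ℕ → VarSet

RuleHolds : Trace → Rule → Set
RuleHolds V (static p α) = ∀ t → V t p ≡ beval (V t) α
RuleHolds V (delay p q)  = (V zero p ≡ false) × (∀ t → V (suc t) p ≡ V t q)
RuleHolds V (since q₁ q₂ a b) =
    (∀ i → (V zero (hd i) ≡ true) ⇔ (i ≡ qinitS))
  × (∀ t i → (V (suc t) (hd i) ≡ true) ⇔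
        (∃ λ j → ∃ λ σa → ∃ λ σb →
            (δS j σa σb ≡ i) × (V t (hd j) ≡ true)
          × (V (suc t) a ≡ σa) × (V (suc t) b ≡ σb)))
  where
  hd : Fin 2 → Var
  hd zero    = q₁
  hd (suc _) = q₂

Solution : Program → Interp → Trace → Set
Solution P I V =
    (∀ r → r ∈ P → RuleHolds V r)
  × (∀ v → ¬ (v ∈ heads P) → ∀ t → V t v ≡ at I t v)

Equivalent : Formula → Program → Var → Set
Equivalent φ P p =
  ∀ (I : Interp) → ¬ (I ≡ []) → ∀ t → 1 ≤ t → t ≤ length I →
  ∀ (V : Trace) → Solution P I V →
  (V t p ≡ true) ⇔ (I , t ⊨ φ)

{-# OPTIONS --safe #-}

-- The translation introduces one fresh variable per subformula, numbered
-- increasingly, so the program is definitorial and nonrecursive (every body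
-- variable is smaller than the head it defines) and each connective costs at
-- most six units of size.  Boolean connectives become static rules, ⊖ a delay
-- rule, and α S β a single since-rule: its heads encode the state of the
-- automaton S one-hot, and S enters its accepting state exactly when b holds,
-- or a holds and it was already accepting, which is the unfolding
-- (α S β)ₜ₊₁ ⇔ βₜ₊₁ ∨ (αₜ₊₁ ∧ (α S β)ₜ).

module Submission where

open import Defs
open import Data.Nat using (ℕ; zero; suc; _+_; _*_; _≤_; _<_; _⊔_; z≤n; s≤s; _≟_; s≤s⁻¹)
open import Data.Nat.Properties
open import Data.Bool using (Bool; true; false; not; _∧_; _∨_)
open import Data.Bool.Properties using (∧-zeroʳ; ∧-identityʳ)
open import Data.Fin using (Fin; zero; suc)
open import Data.List using ([]; _∷_)
open import Data.List.Relation.Unary.Any using (here; there)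
open import Data.List.Relation.Unary.All using ([]; _∷_)
open import Data.List.Relation.Unary.AllPairs using ([]; _∷_)
open import Data.List.Relation.Unary.Unique.Propositional using (Unique)
open import Data.List.Relation.Unary.Unique.Propositional.Properties using (++⁺)
open import Data.List.Relation.Binary.Subset.Propositional using (_⊆_)
open import Data.List.Membership.Propositional using (_∈_)
open import Data.List.Membership.Propositional.Properties using (∈-++⁻)
open import Data.Product using (∃; _×_; _,_; proj₁; proj₂)
open import Data.Product.Function.NonDependent.Propositional using (_×-⇔_)
open import Data.Sum using (_⊎_; inj₁; inj₂)
open import Data.Sum.Function.Propositional using (_⊎-⇔_)
open import Function.Base using (_∘_; case_of_)
open import Function.Bundles using (_⇔_; mk⇔; Equivalence)
open import Function.Construct.Composition using (_⇔-∘_)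
open import Function.Construct.Identity using (⇔-id)
open import Function.Construct.Symmetry using (⇔-sym)
open import Function.Related.TypeIsomorphisms using (¬-cong-⇔)
open import Relation.Nullary using (¬_; yes; no; contradiction)
open import Relation.Binary.PropositionalEquality using (_≡_; refl; sym; trans; cong; module ≡-Reasoning)

open Equivalence

∧-≡-true : ∀ {x y} → (x ∧ y ≡ true) ⇔ (x ≡ true × y ≡ true)
∧-≡-true {true}  = mk⇔ (refl ,_) proj₂
∧-≡-true {false} = mk⇔ (λ ()) (λ ())

∨-≡-true : ∀ {x y} → (x ∨ y ≡ true) ⇔ (x ≡ true ⊎ y ≡ true)
∨-≡-true {true}  = mk⇔ inj₁ (λ _ → refl)
∨-≡-true {false} = mk⇔ inj₂ λ { (inj₁ ()) ; (inj₂ e) → e }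

not-≡-true : ∀ {x} → (not x ≡ true) ⇔ (¬ x ≡ true)
not-≡-true {true}  = mk⇔ (λ ()) (λ x≢true → contradiction refl x≢true)
not-≡-true {false} = mk⇔ (λ _ ()) (λ _ → refl)

subst-≡-true : ∀ {x y} {C : Set} → x ≡ y → (y ≡ true) ⇔ C → (x ≡ true) ⇔ C
subst-≡-true refl y⇔C = y⇔C

≡-false-⇔ : ∀ {x} {C : Set} → x ≡ false → ¬ C → (x ≡ true) ⇔ C
≡-false-⇔ refl ¬C = mk⇔ (λ ()) (λ c → contradiction c ¬C)

S-zero : ∀ {I α β} → ¬ (I , 0 ⊨ (α S β))
S-zero (j , 1≤j , j≤0 , _) = <⇒≱ 1≤j j≤0

S-unfold : ∀ {I t α β} →
  (I , suc t ⊨ (α S β)) ⇔ ((I , suc t ⊨ β) ⊎ ((I , suc t ⊨ α) × (I , t ⊨ (α S β))))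
S-unfold {I} {t} {α} {β} = mk⇔ split join
  where
  split : I , suc t ⊨ (α S β) → (I , suc t ⊨ β) ⊎ ((I , suc t ⊨ α) × (I , t ⊨ (α S β)))
  split (j , 1≤j , j≤1+t , βj , αafter) with j ≟ suc t
  ... | yes refl = inj₁ βj
  ... | no j≢1+t = inj₂ (αafter (suc t) j<1+t ≤-refl ,
                         j , 1≤j , s≤s⁻¹ j<1+t , βj , λ k j<k k≤t → αafter k j<k (m≤n⇒m≤1+n k≤t))
    where
    j<1+t : j < suc t
    j<1+t = ≤∧≢⇒< j≤1+t j≢1+t
  join : (I , suc t ⊨ β) ⊎ ((I , suc t ⊨ α) × (I , t ⊨ (α S β))) → I , suc t ⊨ (α S β)
  join (inj₁ βnow) =
    suc t , s≤s z≤n , ≤-refl , βnow , λ k 1+t<k k≤1+t → contradiction k≤1+t (<⇒≱ 1+t<k)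
  join (inj₂ (αnow , j , 1≤j , j≤t , βj , αafter)) = j , 1≤j , m≤n⇒m≤1+n j≤t , βj , αafter′
    where
    αafter′ : ∀ k → j < k → k ≤ suc t → I , k ⊨ α
    αafter′ k j<k k≤1+t with k ≟ suc t
    ... | yes refl = αnow
    ... | no k≢1+t = αafter k j<k (s≤s⁻¹ (≤∧≢⇒< k≤1+t k≢1+t))

Tracks : Trace → Interp → Var → Formula → Set
Tracks V I p φ = ∀ t → (V t p ≡ true) ⇔ (I , t ⊨ φ)

δS-accepting : ∀ q A B → (suc zero ≡ δS q A B) ⇔ (B ≡ true ⊎ (A ≡ true × suc zero ≡ q))
δS-accepting q true  true  = mk⇔ (λ _ → inj₁ refl) (λ _ → refl)
δS-accepting q false true  = mk⇔ (λ _ → inj₁ refl) (λ _ → refl)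
δS-accepting q true  false = mk⇔ (λ accepting → inj₂ (refl , accepting)) λ where
  (inj₁ ())
  (inj₂ (_ , accepting)) → accepting
δS-accepting q false false = mk⇔ (λ ()) λ { (inj₁ ()) ; (inj₂ (() , _)) }

OneHot : (Fin 2 → Bool) → Fin 2 → Set
OneHot H s = ∀ i → (H i ≡ true) ⇔ (i ≡ s)

oneHot-step : ∀ {H H′ : Fin 2 → Bool} {A B s} → OneHot H s →
  (∀ i → (H′ i ≡ true) ⇔ (∃ λ j → ∃ λ σa → ∃ λ σb →
           (δS j σa σb ≡ i) × (H j ≡ true) × (A ≡ σa) × (B ≡ σb))) →
  OneHot H′ (δS s A B)
oneHot-step {H = H} {A = A} {B = B} {s = s} oneHot advance i =
  mk⇔ (reached ∘ to (advance i))
      λ { refl → from (advance i) (s , A , B , refl , from (oneHot s) refl , refl , refl) }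
  where
  reached : ∀ {i} → (∃ λ j → ∃ λ σa → ∃ λ σb →
                       (δS j σa σb ≡ i) × (H j ≡ true) × (A ≡ σa) × (B ≡ σb)) →
            i ≡ δS s A B
  reached (j , _ , _ , refl , Hj , refl , refl) with to (oneHot j) Hj
  ... | refl = refl

stateS : (ℕ → Bool) → (ℕ → Bool) → ℕ → Fin 2
stateS A B zero    = qinitS
stateS A B (suc t) = δS (stateS A B t) (A (suc t)) (B (suc t))

oneHot-run : ∀ {V : Trace} {head : Fin 2 → Var} {a b} →
  OneHot (λ i → V zero (head i)) qinitS →
  (∀ t i → (V (suc t) (head i) ≡ true) ⇔ (∃ λ j → ∃ λ σa → ∃ λ σb →
             (δS j σa σb ≡ i) × (V t (head j) ≡ true) × (V (suc t) a ≡ σa) × (V (suc t) b ≡ σb))) →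
  ∀ t → OneHot (λ i → V t (head i)) (stateS (λ t → V t a) (λ t → V t b) t)
oneHot-run init advance zero    = init
oneHot-run {V} {head} init advance (suc t) =
  oneHot-step (oneHot-run {V} {head} init advance t) (advance t)

stateS-accepting : ∀ {I α β} {A B : ℕ → Bool} →
  (∀ t → (A t ≡ true) ⇔ (I , t ⊨ α)) → (∀ t → (B t ≡ true) ⇔ (I , t ⊨ β)) →
  ∀ t → (suc zero ≡ stateS A B t) ⇔ (I , t ⊨ (α S β))
stateS-accepting Aα Bβ zero    = mk⇔ (λ ()) (λ αSβ → contradiction αSβ S-zero)
stateS-accepting Aα Bβ (suc t) =
  ⇔-sym S-unfold ⇔-∘
    ((Bβ (suc t) ⊎-⇔ (Aα (suc t) ×-⇔ stateS-accepting Aα Bβ t)) ⇔-∘ δS-accepting _ _ _)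

since-correct : ∀ {V I q₁ q₂ a b α β} → RuleHolds V (since q₁ q₂ a b) →
  Tracks V I a α → Tracks V I b β → Tracks V I q₂ (α S β)
since-correct {V} (init , advance) aα bβ t =
  stateS-accepting aα bβ t ⇔-∘ oneHot-run {V} init advance t (suc zero)

Clock : Trace → Var → Set
Clock V w = V zero w ≡ false × (∀ t → V (suc t) w ≡ true)

⊖-correct : ∀ {V I w d a α} → Clock V w → V zero d ≡ false →
  (∀ t → V (suc t) d ≡ V t a ∧ V t w) → Tracks V I a α → Tracks V I d (⊖ α)
⊖-correct clock d₀ d-next aα zero = ≡-false-⇔ d₀ λ { (() , _) }
⊖-correct {V} {a = a} (w₀ , _) d₀ d-next aα (suc zero) =
  ≡-false-⇔ (trans (d-next 0) (trans (cong (V 0 a ∧_) w₀) (∧-zeroʳ _))) λ { (s≤s () , _) }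
⊖-correct {V} {a = a} (_ , w₊) d₀ d-next aα (suc (suc t)) =
  subst-≡-true (trans (d-next (suc t)) (trans (cong (V (suc t) a ∧_) (w₊ t)) (∧-identityʳ _)))
    (mk⇔ (s≤s (s≤s z≤n) ,_) proj₂ ⇔-∘ aα (suc t))

record Compiled : Set where
  constructor compiled
  field
    program : Program
    output  : Var

  fresh : ℕ
  fresh = suc output

open Compiled

-- compile φ w n P extends P by rules defining output (compile φ w n P), using the
-- fresh variables n, n + 1, …  The variable w must hold ⊖ ⊤: a trace has a time
-- point 0 at which e.g. ⊤ holds, so ⊖ α is compiled as ⊖ (α ∧ ⊖ ⊤).
compile : Formula → Var → ℕ → Program → Compiled
compile (var x)  w n P = compiled (static n (bvar x) ∷ P) n
compile ⊤F       w n P = compiled (static n b⊤ ∷ P) n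
compile ⊥F       w n P = compiled (static n b⊥ ∷ P) n
compile (¬F α)   w n P =
  let a = compile α w n P in
  compiled (static (fresh a) (b¬ (bvar (output a))) ∷ program a) (fresh a)
compile (α ∧F β) w n P =
  let a = compile α w n P ; b = compile β w (fresh a) (program a) in
  compiled (static (fresh b) (b∧ (bvar (output a)) (bvar (output b))) ∷ program b) (fresh b)
compile (α ∨F β) w n P =
  let a = compile α w n P ; b = compile β w (fresh a) (program a) in
  compiled (static (fresh b) (b∨ (bvar (output a)) (bvar (output b))) ∷ program b) (fresh b)
compile (⊖ α)    w n P =
  let a = compile α w n P in
  compiled (delay (suc (fresh a)) (fresh a) ∷ static (fresh a) (b∧ (bvar (output a)) (bvar w)) ∷ program a)
           (suc (fresh a))
compile (α S β)  w n P =
  let a = compile α w n P ; b = compile β w (fresh a) (program a) in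
  compiled (since (fresh b) (suc (fresh b)) (output a) (output b) ∷ program b) (suc (fresh b))

compile-extends : ∀ φ {w n P} → P ⊆ program (compile φ w n P)
compile-extends (var x)  = there
compile-extends ⊤F       = there
compile-extends ⊥F       = there
compile-extends (¬F α)   = there ∘ compile-extends α
compile-extends (α ∧F β) = there ∘ compile-extends β ∘ compile-extends α
compile-extends (α ∨F β) = there ∘ compile-extends β ∘ compile-extends α
compile-extends (⊖ α)    = there ∘ there ∘ compile-extends α
compile-extends (α S β)  = there ∘ compile-extends β ∘ compile-extends α

compile-output∈vars : ∀ φ {w n P} → output (compile φ w n P) ∈ vars (program (compile φ w n P))
compile-output∈vars (var x)  = here refl
compile-output∈vars ⊤F       = here refl
compile-output∈vars ⊥F       = here refl
compile-output∈vars (¬F α)   = here refl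
compile-output∈vars (α ∧F β) = here refl
compile-output∈vars (α ∨F β) = here refl
compile-output∈vars (⊖ α)    = here refl
compile-output∈vars (α S β)  = there (here refl)

compile-fresh : ∀ φ {w n P} → n ≤ output (compile φ w n P)
compile-fresh (var x)  = ≤-refl
compile-fresh ⊤F       = ≤-refl
compile-fresh ⊥F       = ≤-refl
compile-fresh (¬F α)   = m≤n⇒m≤1+n (compile-fresh α)
compile-fresh (α ∧F β) = m≤n⇒m≤1+n (≤-trans (m≤n⇒m≤1+n (compile-fresh α)) (compile-fresh β))
compile-fresh (α ∨F β) = m≤n⇒m≤1+n (≤-trans (m≤n⇒m≤1+n (compile-fresh α)) (compile-fresh β))
compile-fresh (⊖ α)    = m≤n⇒m≤1+n (m≤n⇒m≤1+n (compile-fresh α))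
compile-fresh (α S β)  = m≤n⇒m≤1+n (m≤n⇒m≤1+n (≤-trans (m≤n⇒m≤1+n (compile-fresh α)) (compile-fresh β)))

compiledSize : Formula → ℕ
compiledSize (var x)  = 2
compiledSize ⊤F       = 2
compiledSize ⊥F       = 2
compiledSize (¬F α)   = 3 + compiledSize α
compiledSize (α ∧F β) = 4 + (compiledSize β + compiledSize α)
compiledSize (α ∨F β) = 4 + (compiledSize β + compiledSize α)
compiledSize (⊖ α)    = 6 + compiledSize α
compiledSize (α S β)  = 4 + (compiledSize β + compiledSize α)

compile-psize : ∀ φ {w n P} → psize (program (compile φ w n P)) ≡ compiledSize φ + psize P
compile-psize₂ : ∀ α β {w n P} →
  let a = compile α w n P in
  psize (program (compile β w (fresh a) (program a))) ≡ (compiledSize β + compiledSize α) + psize P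

compile-psize (var x)  = refl
compile-psize ⊤F       = refl
compile-psize ⊥F       = refl
compile-psize (¬F α)   = cong (3 +_) (compile-psize α)
compile-psize (α ∧F β) = cong (4 +_) (compile-psize₂ α β)
compile-psize (α ∨F β) = cong (4 +_) (compile-psize₂ α β)
compile-psize (⊖ α)    = cong (6 +_) (compile-psize α)
compile-psize (α S β)  = cong (4 +_) (compile-psize₂ α β)

compile-psize₂ α β {P = P} = begin
  psize (program (compile β _ _ _))                  ≡⟨ compile-psize β ⟩
  compiledSize β + psize (program (compile α _ _ P)) ≡⟨ cong (compiledSize β +_) (compile-psize α) ⟩
  compiledSize β + (compiledSize α + psize P)        ≡⟨ +-assoc (compiledSize β) _ _ ⟨
  compiledSize β + compiledSize α + psize P          ∎
  where open ≡-Reasoning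

fsize≥1 : ∀ φ → 1 ≤ fsize φ
fsize≥1 (var x)  = s≤s z≤n
fsize≥1 ⊤F       = s≤s z≤n
fsize≥1 ⊥F       = s≤s z≤n
fsize≥1 (¬F α)   = s≤s z≤n
fsize≥1 (α ∧F β) = s≤s z≤n
fsize≥1 (α ∨F β) = s≤s z≤n
fsize≥1 (⊖ α)    = s≤s z≤n
fsize≥1 (α S β)  = s≤s z≤n

size-step-≤ : ∀ {k c f} → k ≤ 6 → c ≤ 6 * f → k + c ≤ 6 * suc f
size-step-≤ {f = f} k≤6 c≤6f = ≤-trans (+-mono-≤ k≤6 c≤6f) (≤-reflexive (sym (*-suc 6 f)))

size-step₂-≤ : ∀ {c d} f g → c ≤ 6 * f → d ≤ 6 * g → 4 + (d + c) ≤ 6 * (1 + f + g)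
size-step₂-≤ f g c≤6f d≤6g = size-step-≤ (s≤s (s≤s (s≤s (s≤s z≤n))))
  (≤-trans (+-mono-≤ d≤6g c≤6f) (≤-reflexive (trans (+-comm (6 * g) (6 * f)) (sym (*-distribˡ-+ 6 f g)))))

compiledSize≤ : ∀ φ → compiledSize φ ≤ 6 * fsize φ
compiledSize≤ (var x)  = s≤s (s≤s z≤n)
compiledSize≤ ⊤F       = s≤s (s≤s z≤n)
compiledSize≤ ⊥F       = s≤s (s≤s z≤n)
compiledSize≤ (¬F α)   = size-step-≤ (s≤s (s≤s (s≤s z≤n))) (compiledSize≤ α)
compiledSize≤ (α ∧F β) = size-step₂-≤ (fsize α) (fsize β) (compiledSize≤ α) (compiledSize≤ β)
compiledSize≤ (α ∨F β) = size-step₂-≤ (fsize α) (fsize β) (compiledSize≤ α) (compiledSize≤ β)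
compiledSize≤ (⊖ α)    = size-step-≤ ≤-refl (compiledSize≤ α)
compiledSize≤ (α S β)  = size-step₂-≤ (fsize α) (fsize β) (compiledSize≤ α) (compiledSize≤ β)

Descending : Rule → Set
Descending r = ∀ {u v} → u ∈ ruleHeads r → v ∈ ruleBody r → v < u

descending⇒nonrecursive : ∀ {P} → (∀ {r} → r ∈ P → Descending r) → Nonrecursive P
descending⇒nonrecursive {P} desc v cycle = <-irrefl refl (path-descends cycle)
  where
  path-descends : ∀ {u w} → Path P u w → w < u
  path-descends (step (r , r∈ , u∈ , w∈))    = desc r∈ u∈ w∈
  path-descends ((r , r∈ , u∈ , v∈) ▸ path) = <-trans (path-descends path) (desc r∈ u∈ v∈)

record Layered (L n : ℕ) (P : Program) : Set where
  field
    heads-range  : ∀ {h} → h ∈ heads P → L ≤ h × h < n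
    heads-unique : Unique (heads P)
    descending   : ∀ {r} → r ∈ P → Descending r

Layered-[] : ∀ {L n} → Layered L n []
Layered-[] = record { heads-range = λ () ; heads-unique = [] ; descending = λ () }

Layered-∷ : ∀ {L n n′ P r} → Layered L n P → L ≤ n → n ≤ n′ →
  (∀ {h} → h ∈ ruleHeads r → n ≤ h × h < n′) → (∀ {v} → v ∈ ruleBody r → v < n) →
  Unique (ruleHeads r) → Layered L n′ (r ∷ P)
Layered-∷ {r = r} layered L≤n n≤n′ new-range body< new-unique = record
  { heads-range  = λ h∈ → case ∈-++⁻ (ruleHeads r) h∈ of λ where
      (inj₁ h∈new) → ≤-trans L≤n (proj₁ (new-range h∈new)) , proj₂ (new-range h∈new)
      (inj₂ h∈old) → proj₁ (heads-range h∈old) , <-≤-trans (proj₂ (heads-range h∈old)) n≤n′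
  ; heads-unique = ++⁺ new-unique heads-unique
      λ (h∈new , h∈old) → <⇒≱ (proj₂ (heads-range h∈old)) (proj₁ (new-range h∈new))
  ; descending   = λ where
      (here refl) u∈ v∈ → <-≤-trans (body< v∈) (proj₁ (new-range u∈))
      (there r∈)        → descending r∈
  }
  where open Layered layered

Layered-static : ∀ {L n P α} → Layered L n P → L ≤ n → (∀ {v} → v ∈ bvars α → v < n) →
  Layered L (suc n) (static n α ∷ P)
Layered-static layered L≤n body< =
  Layered-∷ layered L≤n (n≤1+n _) (λ { (here refl) → ≤-refl , ≤-refl }) body< ([] ∷ [])

Layered-delay : ∀ {L n P q} → Layered L n P → L ≤ n → q < n → Layered L (suc n) (delay n q ∷ P)
Layered-delay layered L≤n q<n =
  Layered-∷ layered L≤n (n≤1+n _) (λ { (here refl) → ≤-refl , ≤-refl }) (λ { (here refl) → q<n })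
    ([] ∷ [])

Layered-since : ∀ {L n P a b} → Layered L n P → L ≤ n → a < n → b < n →
  Layered L (suc (suc n)) (since n (suc n) a b ∷ P)
Layered-since layered L≤n a<n b<n = Layered-∷ layered L≤n (m≤n⇒m≤1+n (n≤1+n _))
  (λ { (here refl) → ≤-refl , n≤1+n _ ; (there (here refl)) → n≤1+n _ , ≤-refl })
  (λ { (here refl) → a<n ; (there (here refl)) → b<n })
  (((λ ()) ∷ []) ∷ [] ∷ [])

varBound : Formula → ℕ
varBound (var x)  = suc x
varBound ⊤F       = 0
varBound ⊥F       = 0
varBound (¬F α)   = varBound α
varBound (α ∧F β) = varBound α ⊔ varBound β
varBound (α ∨F β) = varBound α ⊔ varBound β
varBound (⊖ α)    = varBound α
varBound (α S β)  = varBound α ⊔ varBound β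

compile-layered : ∀ φ {w n P L} → varBound φ ≤ L → L ≤ n → w < n → Layered L n P →
  Layered L (fresh (compile φ w n P)) (program (compile φ w n P))
compile-layered₂ : ∀ α β {w n P L} → varBound α ⊔ varBound β ≤ L → L ≤ n → w < n →
  Layered L n P →
  let a = compile α w n P ; b = compile β w (fresh a) (program a) in
  Layered L (fresh b) (program b) × L ≤ fresh b × output a < fresh b

compile-layered (var x)  x<L L≤n w<n layered =
  Layered-static layered L≤n λ { (here refl) → <-≤-trans x<L L≤n }
compile-layered ⊤F       _   L≤n w<n layered = Layered-static layered L≤n λ ()
compile-layered ⊥F       _   L≤n w<n layered = Layered-static layered L≤n λ ()
compile-layered (¬F α)   φ≤L L≤n w<n layered =
  Layered-static (compile-layered α φ≤L L≤n w<n layered) (≤-trans L≤n (m≤n⇒m≤1+n (compile-fresh α)))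
    λ { (here refl) → ≤-refl }
compile-layered (α ∧F β) φ≤L L≤n w<n layered =
  let layered′ , L≤ , a< = compile-layered₂ α β φ≤L L≤n w<n layered in
  Layered-static layered′ L≤ λ { (here refl) → a< ; (there (here refl)) → ≤-refl }
compile-layered (α ∨F β) φ≤L L≤n w<n layered =
  let layered′ , L≤ , a< = compile-layered₂ α β φ≤L L≤n w<n layered in
  Layered-static layered′ L≤ λ { (here refl) → a< ; (there (here refl)) → ≤-refl }
compile-layered (⊖ α) {w} {n} {P} {L} φ≤L L≤n w<n layered =
  Layered-delay
    (Layered-static (compile-layered α φ≤L L≤n w<n layered) L≤
      λ { (here refl) → ≤-refl ; (there (here refl)) → <-≤-trans w<n (m≤n⇒m≤1+n (compile-fresh α)) })
    (m≤n⇒m≤1+n L≤) ≤-refl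
  where
  L≤ : L ≤ fresh (compile α w n P)
  L≤ = ≤-trans L≤n (m≤n⇒m≤1+n (compile-fresh α))
compile-layered (α S β)  φ≤L L≤n w<n layered =
  let layered′ , L≤ , a< = compile-layered₂ α β φ≤L L≤n w<n layered in
  Layered-since layered′ L≤ a< ≤-refl

compile-layered₂ α β {w} {n} {P} {L} φ≤L L≤n w<n layered =
  compile-layered β (m⊔n≤o⇒n≤o _ _ φ≤L) L≤a (<-≤-trans w<n n≤a)
    (compile-layered α (m⊔n≤o⇒m≤o _ _ φ≤L) L≤n w<n layered) ,
  m≤n⇒m≤1+n (≤-trans L≤a (compile-fresh β)) ,
  s≤s (≤-trans (n≤1+n _) (compile-fresh β))
  where
  n≤a : n ≤ fresh (compile α w n P)
  n≤a = m≤n⇒m≤1+n (compile-fresh α)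
  L≤a : L ≤ fresh (compile α w n P)
  L≤a = ≤-trans L≤n n≤a

Satisfies : Trace → Program → Set
Satisfies V P = ∀ {r} → r ∈ P → RuleHolds V r

module _ {L : ℕ} {I : Interp} {V : Trace} {w : Var}
         (inputs : ∀ {x} → x < L → ∀ t → V t x ≡ at I t x) (clock : Clock V w) where

  compile-correct : ∀ φ {n P} → varBound φ ≤ L → Satisfies V (program (compile φ w n P)) →
    Tracks V I (output (compile φ w n P)) φ
  compile-correct₂ : ∀ α β {n P} → varBound α ⊔ varBound β ≤ L →
    let a = compile α w n P ; b = compile β w (fresh a) (program a) in
    Satisfies V (program b) → Tracks V I (output a) α × Tracks V I (output b) β

  compile-correct (var x)  x<L holds t = subst-≡-true (trans (holds (here refl) t) (inputs x<L t)) (⇔-id _)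
  compile-correct ⊤F       _   holds t = mk⇔ _ (λ _ → holds (here refl) t)
  compile-correct ⊥F       _   holds t = ≡-false-⇔ (holds (here refl) t) λ ()
  compile-correct (¬F α)   φ≤L holds t =
    subst-≡-true (holds (here refl) t)
      (¬-cong-⇔ (compile-correct α φ≤L (holds ∘ there) t) ⇔-∘ not-≡-true)
  compile-correct (α ∧F β) φ≤L holds t =
    let aα , bβ = compile-correct₂ α β φ≤L (holds ∘ there) in
    subst-≡-true (holds (here refl) t) ((aα t ×-⇔ bβ t) ⇔-∘ ∧-≡-true)
  compile-correct (α ∨F β) φ≤L holds t =
    let aα , bβ = compile-correct₂ α β φ≤L (holds ∘ there) in
    subst-≡-true (holds (here refl) t) ((aα t ⊎-⇔ bβ t) ⇔-∘ ∨-≡-true)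
  compile-correct (⊖ α)    φ≤L holds =
    ⊖-correct {V} clock (proj₁ (holds (here refl)))
      (λ t → trans (proj₂ (holds (here refl)) t) (holds (there (here refl)) t))
      (compile-correct α φ≤L (holds ∘ there ∘ there))
  compile-correct (α S β)  φ≤L holds =
    let aα , bβ = compile-correct₂ α β φ≤L (holds ∘ there) in
    since-correct {V} (holds (here refl)) aα bβ

  compile-correct₂ α β φ≤L holds =
    compile-correct α (m⊔n≤o⇒m≤o _ _ φ≤L) (holds ∘ compile-extends β) ,
    compile-correct β (m⊔n≤o⇒n≤o _ _ φ≤L) holds

clockProgram : Var → Program
clockProgram c = delay (suc c) c ∷ static c b⊤ ∷ []

translate : Formula → Compiled
translate φ = compile φ (suc L) (suc (suc L)) (clockProgram L)
  where
  L : ℕ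
  L = varBound φ

translate-layered : ∀ φ → Layered (varBound φ) (fresh (translate φ)) (program (translate φ))
translate-layered φ =
  compile-layered φ ≤-refl (m≤n⇒m≤1+n (n≤1+n _)) ≤-refl
    (Layered-delay (Layered-static Layered-[] ≤-refl λ ()) (n≤1+n _) ≤-refl)

translate-InLS : ∀ φ → InLS (program (translate φ))
translate-InLS φ = descending⇒nonrecursive descending , heads-unique
  where open Layered (translate-layered φ)

translate-psize : ∀ φ → psize (program (translate φ)) ≤ 10 * fsize φ
translate-psize φ = begin
  psize (program (translate φ)) ≡⟨ compile-psize φ ⟩
  compiledSize φ + 4            ≤⟨ +-mono-≤ (compiledSize≤ φ) (*-monoʳ-≤ 4 (fsize≥1 φ)) ⟩
  6 * fsize φ + 4 * fsize φ     ≡⟨ *-distribʳ-+ (fsize φ) 6 4 ⟨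
  10 * fsize φ                  ∎
  where open ≤-Reasoning

-- The program agrees with φ at every time point.
translate-equivalent : ∀ φ → Equivalent φ (program (translate φ)) (output (translate φ))
translate-equivalent φ I _ t _ _ V (holds , undefined) =
  compile-correct inputs clock φ ≤-refl (holds _) t
  where
  open Layered (translate-layered φ)
  inputs : ∀ {x} → x < varBound φ → ∀ t → V t x ≡ at I t x
  inputs x<L = undefined _ λ x∈ → <⇒≱ x<L (proj₁ (heads-range x∈))
  clock : Clock V (suc (varBound φ))
  clock = proj₁ delayed , λ t → trans (proj₂ delayed t) (holds _ (compile-extends φ (there (here refl))) t)
    where
    delayed : RuleHolds V (delay (suc (varBound φ)) (varBound φ))
    delayed = holds _ (compile-extends φ (here refl))

theorem11 : ∃ λ (c : ℕ) → ∀ (φ : Formula) →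
              ∃ λ (P : Program) → ∃ λ (p : Var) →
                InLS P × (p ∈ vars P) × (psize P ≤ c * fsize φ)
                × Equivalent φ P p
theorem11 = 10 , λ φ →
  program (translate φ) , output (translate φ) ,
  translate-InLS φ , compile-output∈vars φ , translate-psize φ , translate-equivalent φ
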